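{- Let $Q_{2,1}=\mathrm{conv}\{(0,0),(a,b),(c,d)\}$ and $Q_{2,2}=\mathrm{conv}\{(0,0),(a',b'),(c',d')\}$ be integral $2$-simplices in $\mathbb{R}^2$, let $n>2$, and let $$Q_{n,1}=\mathrm{conv}\{\mathbf{0},(a,b,0,\dots,0),(c,d,0,\dots,0),\mathbf{e_3},\dots,\mathbf{e_n}\},\quad Q_{n,2}=\mathrm{conv}\{\mathbf{0},(a',b',0,\dots,0),(c',d',0,\dots,0),\mathbf{e_3},\dots,\mathbf{e_n}\}.$$ Let $U(\mathbf{v})=M\mathbf{v}+\mathbf{u}$ with $M\in\operatorname{GL}_n(\mathbb{Z})$, $\mathbf{u}\in\mathbb{Z}^n$ satisfy $U(Q_{n,1})=Q_{n,2}$. If $U(\mathbf{0})=\mathbf{e_i}$ for some $3\le i\le n$, then, with $\ell=\gcd(c-a,d-b)$, $$\begin{pmatrix}a&\frac{c-a}{\ell}\\ b&\frac{d-b}{\ell}\end{pmatrix}\in\operatorname{GL}_2(\mathbb{Z}).$$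
   Context: $a,b,c,d,a',b',c',d'\in\mathbb{Z}$ and $\mathbf{e_i}$ denotes the $i$-th standard basis vector of $\mathbb{R}^n$. -}

module Defs where

open import Data.Nat as ℕ using (ℕ; zero; suc)
open import Data.Fin using (Fin; zero; suc; toℕ)
open import Data.Integer as ℤ using (ℤ)
open import Data.Rational as ℚ using (ℚ; 0ℚ; 1ℚ)
open import Data.Product using (Σ; ∃; _×_; _,_)
open import Relation.Binary.PropositionalEquality using (_≡_)

sumℚ : ∀ {k} → (Fin k → ℚ) → ℚ
sumℚ {zero} f = 0ℚ
sumℚ {suc k} f = f zero ℚ.+ sumℚ (λ j → f (suc j))

sumℤ : ∀ {k} → (Fin k → ℤ) → ℤ
sumℤ {zero} f = ℤ.0ℤ
sumℤ {suc k} f = f zero ℤ.+ sumℤ (λ j → f (suc j))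

Mat : ℕ → Set
Mat n = Fin n → Fin n → ℤ

δ : ∀ {n} → Fin n → Fin n → ℤ
δ zero zero = ℤ.1ℤ
δ zero (suc j) = ℤ.0ℤ
δ (suc i) zero = ℤ.0ℤ
δ (suc i) (suc j) = δ i j

_⊗_ : ∀ {n} → Mat n → Mat n → Mat n
(M ⊗ N) i j = sumℤ (λ k → M i k ℤ.* N k j)

InGL : ∀ n → Mat n → Set
InGL n M = Σ (Mat n) λ N → (∀ i j → (M ⊗ N) i j ≡ δ i j) × (∀ i j → (N ⊗ M) i j ≡ δ i j)

mat2 : ℤ → ℤ → ℤ → ℤ → Mat 2
mat2 x y z w zero zero = x
mat2 x y z w zero (suc zero) = y
mat2 x y z w (suc zero) zero = z
mat2 x y z w (suc zero) (suc zero) = w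

Vecℤ : ℕ → Set
Vecℤ n = Fin n → ℤ

Vecℚ : ℕ → Set
Vecℚ n = Fin n → ℚ

toℚ : ℤ → ℚ
toℚ z = z ℚ./ 1

e : ∀ {n} → Fin n → Vecℤ n
e i = δ i

pad2 : ∀ {n} → ℤ → ℤ → Vecℤ n
pad2 x y zero = x
pad2 x y (suc zero) = y
pad2 x y (suc (suc _)) = ℤ.0ℤ

-- Vertices of Q_{n} = conv{0, (a,b,0..), (c,d,0..), e_3, ..., e_n}, indexed by Fin (suc n):
-- index 0 ↦ 0, index 1 ↦ (a,b,0..), index 2 ↦ (c,d,0..), index k+1 (k ≥ 2) ↦ e_k (0-indexed, i.e. e_{k+1} 1-indexed).
vertsQ : ∀ n → ℤ → ℤ → ℤ → ℤ → Fin (suc n) → Vecℤ n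
vertsQ n a b c d zero = λ _ → ℤ.0ℤ
vertsQ n a b c d (suc k) with toℕ k
... | zero = pad2 a b
... | suc zero = pad2 c d
... | suc (suc _) = e k

InConv : ∀ {n k} → (Fin k → Vecℤ n) → Vecℚ n → Set
InConv {n} {k} V x =
  Σ (Fin k → ℚ) λ λs →
    (∀ j → 0ℚ ℚ.≤ λs j) × (sumℚ λs ≡ 1ℚ) ×
    (∀ i → x i ≡ sumℚ (λ j → λs j ℚ.* toℚ (V j i)))

affine : ∀ {n} → Mat n → Vecℤ n → Vecℚ n → Vecℚ n
affine M u v i = sumℚ (λ j → toℚ (M i j) ℚ.* v j) ℚ.+ toℚ (u i)

-- U(P) = P' as sets (restricted to rational points).
MapsOnto : ∀ {n k} → Mat n → Vecℤ n → (Fin k → Vecℤ n) → (Fin k → Vecℤ n) → Set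
MapsOnto {n} M u V W =
  (∀ x → InConv V x → InConv W (affine M u x)) ×
  (∀ y → InConv W y → Σ (Vecℚ n) λ x → InConv V x × (∀ i → affine M u x i ≡ y i))

{-# OPTIONS --safe #-}
-- Let U(0) = e_r, one of the vertices e_3, …, e_n of Q_{n,2}. The r-th coordinate vanishes at every vertex of
-- Q_{n,2} except e_r, where it is 1, so on Q_{n,2} it is the barycentric weight of e_r: it lies
-- in [0,1] and equals 1 only at e_r. For a nonzero vertex v of Q_{n,1} the integer U(v)_r =
-- (Mv)_r + 1 is therefore 0 or 1, and 1 is impossible since U(v) = e_r = U(0) would put v in the
-- kernel of M. So the row m = (M_r1, M_r2) takes the value -1 at both (a,b) and (c,d), hence
-- kills the primitive direction (x,y) = ((c,d) - (a,b)) / ℓ. By Cramer's rule the determinant of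
-- [[a,x],[b,y]] then divides x and y, which are coprime, so it is a unit.
module Submission where

open import Defs
open import Data.Nat as ℕ using (ℕ; suc; zero)
open import Data.Fin using (Fin; toℕ; zero; suc)
open import Data.Integer as ℤ using (ℤ; 0ℤ; 1ℤ; -1ℤ; _+_; _*_; _-_; -_)
import Data.Integer.Properties as ℤP
open import Data.Integer.Divisibility.Signed using (_∣_; divides; ∣ᵤ⇒∣; ∣⇒∣ᵤ; *-monoˡ-∣; *-cancelʳ-∣)
open import Data.Integer.GCD using (gcd; gcd-greatest; gcd[i,j]≡0⇒i≡0; gcd[i,j]≡0⇒j≡0)
open import Data.Integer.Tactic.RingSolver using (solve)
open import Data.Rational as ℚ using (ℚ; 0ℚ; 1ℚ)
import Data.Rational.Properties as ℚP
open import Data.Rational.Literals using (fromℤ)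
import Algebra.Properties.AbelianGroup as AbelianGroupProperties
import Algebra.Properties.Group as GroupProperties
import Algebra.Properties.Semiring.Sum as SemiringSum
open import Data.List using (_∷_; [])
open import Data.Product using (Σ; _×_; _,_; proj₁; proj₂)
open import Data.Sum as Sum using (_⊎_; inj₁; inj₂; [_,_]′)
open import Data.Empty using (⊥-elim)
open import Function using (_∘_; id; _∋_)
open import Relation.Nullary using (¬_)
open import Relation.Binary.PropositionalEquality

private
  module Σℤ = SemiringSum ℤP.+-*-semiring
  module ℤ+ = AbelianGroupProperties ℤP.+-0-abelianGroup
  module ℚ+ = GroupProperties ℚP.+-0-group

open ≡-Reasoning

toℚ≡fromℤ : ∀ i → toℚ i ≡ fromℤ i
toℚ≡fromℤ i = ℚP.↥p/↧p≡p (fromℤ i)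

toℚ-homo-+ : ∀ i j → toℚ (i + j) ≡ toℚ i ℚ.+ toℚ j
toℚ-homo-+ i j rewrite toℚ≡fromℤ i | toℚ≡fromℤ j | ℤP.*-identityʳ i | ℤP.*-identityʳ j = refl

toℚ-homo-* : ∀ i j → toℚ (i * j) ≡ toℚ i ℚ.* toℚ j
toℚ-homo-* i j rewrite toℚ≡fromℤ i | toℚ≡fromℤ j = refl

toℚ-injective : ∀ {i j} → toℚ i ≡ toℚ j → i ≡ j
toℚ-injective {i} {j} eq rewrite toℚ≡fromℤ i | toℚ≡fromℤ j = cong ℚ.↥_ eq

toℚ-cancel-≤ : ∀ {i j} → toℚ i ℚ.≤ toℚ j → i ℤ.≤ j
toℚ-cancel-≤ {i} {j} le rewrite toℚ≡fromℤ i | toℚ≡fromℤ j with ℚP.drop-*≤* le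
... | i*1≤j*1 rewrite ℤP.*-identityʳ i | ℤP.*-identityʳ j = i*1≤j*1

0≤i≤1⇒i≡0⊎i≡1 : ∀ {i} → 0ℤ ℤ.≤ i → i ℤ.≤ 1ℤ → i ≡ 0ℤ ⊎ i ≡ 1ℤ
0≤i≤1⇒i≡0⊎i≡1 (ℤ.+≤+ _) (ℤ.+≤+ ℕ.z≤n) = inj₁ refl
0≤i≤1⇒i≡0⊎i≡1 (ℤ.+≤+ _) (ℤ.+≤+ (ℕ.s≤s ℕ.z≤n)) = inj₂ refl

sumℤ≡sum : ∀ {k} (f : Fin k → ℤ) → sumℤ f ≡ Σℤ.sum f
sumℤ≡sum {zero} f = refl
sumℤ≡sum {suc k} f = cong (f zero +_) (sumℤ≡sum (f ∘ suc))

sumℤ-cong : ∀ {k} {f g : Fin k → ℤ} → (∀ j → f j ≡ g j) → sumℤ f ≡ sumℤ g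
sumℤ-cong {f = f} {g} f≗g = trans (sumℤ≡sum f) (trans (Σℤ.sum-cong-≗ f≗g) (sym (sumℤ≡sum g)))

sumℤ-zero : ∀ {k} {f : Fin k → ℤ} → (∀ j → f j ≡ 0ℤ) → sumℤ f ≡ 0ℤ
sumℤ-zero {k} f≡0 = trans (sumℤ-cong f≡0) (trans (sumℤ≡sum {k} (λ _ → 0ℤ)) (Σℤ.sum-replicate-zero k))

*-distribˡ-sumℤ : ∀ {k} x (f : Fin k → ℤ) → x * sumℤ f ≡ sumℤ (λ j → x * f j)
*-distribˡ-sumℤ x f =
  trans (cong (x *_) (sumℤ≡sum f)) (trans (Σℤ.*-distribˡ-sum x f) (sym (sumℤ≡sum (λ j → x * f j))))

*-distribʳ-sumℤ : ∀ {k} x (f : Fin k → ℤ) → sumℤ f * x ≡ sumℤ (λ j → f j * x)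
*-distribʳ-sumℤ x f =
  trans (cong (_* x) (sumℤ≡sum f)) (trans (Σℤ.*-distribʳ-sum x f) (sym (sumℤ≡sum (λ j → f j * x))))

sumℤ-comm : ∀ {k m} (f : Fin k → Fin m → ℤ) →
  sumℤ (λ l → sumℤ (λ j → f j l)) ≡ sumℤ (λ j → sumℤ (λ l → f j l))
sumℤ-comm f = trans (double-sum (λ l j → f j l)) (trans (Σℤ.∑-comm (λ l j → f j l)) (sym (double-sum f)))
  where
  double-sum : ∀ {k m} (g : Fin k → Fin m → ℤ) →
    sumℤ (λ j → sumℤ (g j)) ≡ Σℤ.sum (λ j → Σℤ.sum (g j))
  double-sum g = trans (sumℤ≡sum (λ j → sumℤ (g j))) (Σℤ.sum-cong-≗ (λ j → sumℤ≡sum (g j)))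

δ-sym : ∀ {k} (i j : Fin k) → δ i j ≡ δ j i
δ-sym zero zero = refl
δ-sym zero (suc j) = refl
δ-sym (suc i) zero = refl
δ-sym (suc i) (suc j) = δ-sym i j

δ-refl : ∀ {k} (i : Fin k) → δ i i ≡ 1ℤ
δ-refl zero = refl
δ-refl (suc i) = δ-refl i

toℚ-δ-nonneg : ∀ {k} (i j : Fin k) → 0ℚ ℚ.≤ toℚ (δ i j)
toℚ-δ-nonneg zero zero = ℚ.*≤* (ℤ.+≤+ ℕ.z≤n)
toℚ-δ-nonneg zero (suc j) = ℚP.≤-refl
toℚ-δ-nonneg (suc i) zero = ℚP.≤-refl
toℚ-δ-nonneg (suc i) (suc j) = toℚ-δ-nonneg i j

sumℚ-cong : ∀ {k} {f g : Fin k → ℚ} → (∀ j → f j ≡ g j) → sumℚ f ≡ sumℚ g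
sumℚ-cong {zero} _ = refl
sumℚ-cong {suc k} f≗g = cong₂ ℚ._+_ (f≗g zero) (sumℚ-cong (f≗g ∘ suc))

sumℚ-zero : ∀ {k} {f : Fin k → ℚ} → (∀ j → f j ≡ 0ℚ) → sumℚ f ≡ 0ℚ
sumℚ-zero {zero} _ = refl
sumℚ-zero {suc k} f≡0 = cong₂ ℚ._+_ (f≡0 zero) (sumℚ-zero (f≡0 ∘ suc))

sumℚ-δˡ : ∀ {k} (i : Fin k) (g : Fin k → ℚ) → sumℚ (λ j → toℚ (δ i j) ℚ.* g j) ≡ g i
sumℚ-δˡ zero g =
  trans (cong₂ ℚ._+_ (ℚP.*-identityˡ (g zero)) (sumℚ-zero (λ j → ℚP.*-zeroˡ (g (suc j)))))
        (ℚP.+-identityʳ (g zero))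
sumℚ-δˡ (suc i) g =
  trans (cong₂ ℚ._+_ (ℚP.*-zeroˡ (g zero)) (sumℚ-δˡ i (g ∘ suc))) (ℚP.+-identityˡ (g (suc i)))

sumℚ-δʳ : ∀ {k} (i : Fin k) (g : Fin k → ℚ) → sumℚ (λ j → g j ℚ.* toℚ (δ j i)) ≡ g i
sumℚ-δʳ i g =
  trans (sumℚ-cong (λ j → trans (ℚP.*-comm (g j) _) (cong (λ t → toℚ t ℚ.* g j) (δ-sym j i)))) (sumℚ-δˡ i g)

toℚ-sumℤ : ∀ {k} (f : Fin k → ℤ) → toℚ (sumℤ f) ≡ sumℚ (toℚ ∘ f)
toℚ-sumℤ {zero} f = refl
toℚ-sumℤ {suc k} f = trans (toℚ-homo-+ (f zero) _) (cong (toℚ (f zero) ℚ.+_) (toℚ-sumℤ (f ∘ suc)))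

sumℤ-δˡ : ∀ {k} (i : Fin k) (g : Fin k → ℤ) → sumℤ (λ j → δ i j * g j) ≡ g i
sumℤ-δˡ i g = toℚ-injective (begin
  toℚ (sumℤ (λ j → δ i j * g j))           ≡⟨ toℚ-sumℤ (λ j → δ i j * g j) ⟩
  sumℚ (λ j → toℚ (δ i j * g j))           ≡⟨ sumℚ-cong (λ j → toℚ-homo-* (δ i j) (g j)) ⟩
  sumℚ (λ j → toℚ (δ i j) ℚ.* toℚ (g j))   ≡⟨ sumℚ-δˡ i (toℚ ∘ g) ⟩
  toℚ (g i)                                ∎)

p≤p+q : ∀ p {q} → 0ℚ ℚ.≤ q → p ℚ.≤ p ℚ.+ q
p≤p+q p {q} 0≤q = subst (ℚ._≤ p ℚ.+ q) (ℚP.+-identityʳ p) (ℚP.+-monoʳ-≤ p 0≤q)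

p≤q+p : ∀ p {q} → 0ℚ ℚ.≤ q → p ℚ.≤ q ℚ.+ p
p≤q+p p {q} 0≤q = subst (p ℚ.≤_) (ℚP.+-comm p q) (p≤p+q p 0≤q)

sumℚ-nonneg : ∀ {k} {f : Fin k → ℚ} → (∀ j → 0ℚ ℚ.≤ f j) → 0ℚ ℚ.≤ sumℚ f
sumℚ-nonneg {zero} _ = ℚP.≤-refl
sumℚ-nonneg {suc k} f≥0 = ℚP.+-mono-≤ (f≥0 zero) (sumℚ-nonneg (f≥0 ∘ suc))

term≤sumℚ : ∀ {k} {f : Fin k → ℚ} → (∀ j → 0ℚ ℚ.≤ f j) → ∀ j → f j ℚ.≤ sumℚ f
term≤sumℚ {f = f} f≥0 zero = p≤p+q (f zero) (sumℚ-nonneg (f≥0 ∘ suc))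
term≤sumℚ f≥0 (suc j) = ℚP.≤-trans (term≤sumℚ (f≥0 ∘ suc) j) (p≤q+p _ (f≥0 zero))

sumℚ≡0⇒≡0 : ∀ {k} {f : Fin k → ℚ} → (∀ j → 0ℚ ℚ.≤ f j) → sumℚ f ≡ 0ℚ → ∀ j → f j ≡ 0ℚ
sumℚ≡0⇒≡0 {f = f} f≥0 Σf≡0 j = ℚP.≤-antisym (subst (f j ℚ.≤_) Σf≡0 (term≤sumℚ f≥0 j)) (f≥0 j)

sumℚ≡1⇒δ : ∀ {k} {f : Fin k → ℚ} → (∀ j → 0ℚ ℚ.≤ f j) → sumℚ f ≡ 1ℚ →
  ∀ i → f i ≡ 1ℚ → ∀ j → f j ≡ toℚ (δ i j)
sumℚ≡1⇒δ {suc k} {f} f≥0 Σf≡1 zero f₀≡1 = at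
  where
  rest≡0 : sumℚ (f ∘ suc) ≡ 0ℚ
  rest≡0 = ℚ+.identityʳ-unique 1ℚ _ (trans (cong (ℚ._+ sumℚ (f ∘ suc)) (sym f₀≡1)) Σf≡1)
  at : ∀ j → f j ≡ toℚ (δ zero j)
  at zero = f₀≡1
  at (suc j) = sumℚ≡0⇒≡0 (f≥0 ∘ suc) rest≡0 j
sumℚ≡1⇒δ {suc k} {f} f≥0 Σf≡1 (suc i) fᵢ≡1 = at
  where
  rest≡1 : sumℚ (f ∘ suc) ≡ 1ℚ
  rest≡1 = ℚP.≤-antisym (subst (sumℚ (f ∘ suc) ℚ.≤_) Σf≡1 (p≤q+p _ (f≥0 zero)))
                        (subst (ℚ._≤ sumℚ (f ∘ suc)) fᵢ≡1 (term≤sumℚ (f≥0 ∘ suc) i))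
  at : ∀ j → f j ≡ toℚ (δ (suc i) j)
  at zero = ℚ+.identityˡ-unique (f zero) 1ℚ (trans (cong (f zero ℚ.+_) (sym rest≡1)) Σf≡1)
  at (suc j) = sumℚ≡1⇒δ (f≥0 ∘ suc) rest≡1 i fᵢ≡1 j

infixr 7 _·_

_·_ : ∀ {n} → Mat n → Vecℤ n → Vecℤ n
(M · w) i = sumℤ (λ l → M i l * w l)

affine-toℚ : ∀ {n} (M : Mat n) (u w : Vecℤ n) i → affine M u (toℚ ∘ w) i ≡ toℚ ((M · w) i + u i)
affine-toℚ M u w i = sym (begin
  toℚ ((M · w) i + u i)                          ≡⟨ toℚ-homo-+ ((M · w) i) (u i) ⟩
  toℚ ((M · w) i) ℚ.+ toℚ (u i)                  ≡⟨ cong (ℚ._+ toℚ (u i)) (toℚ-sumℤ (λ l → M i l * w l)) ⟩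
  sumℚ (λ l → toℚ (M i l * w l)) ℚ.+ toℚ (u i)   ≡⟨ cong (ℚ._+ toℚ (u i)) (sumℚ-cong (λ l → toℚ-homo-* (M i l) (w l))) ⟩
  affine M u (toℚ ∘ w) i                         ∎)

⊗-·-assoc : ∀ {n} (N M : Mat n) (w : Vecℤ n) j → ((N ⊗ M) · w) j ≡ (N · M · w) j
⊗-·-assoc N M w j = begin
  sumℤ (λ l → sumℤ (λ k → N j k * M k l) * w l)   ≡⟨ sumℤ-cong (λ l → *-distribʳ-sumℤ (w l) (λ k → N j k * M k l)) ⟩
  sumℤ (λ l → sumℤ (λ k → N j k * M k l * w l))   ≡⟨ sumℤ-comm (λ k l → N j k * M k l * w l) ⟩
  sumℤ (λ k → sumℤ (λ l → N j k * M k l * w l))   ≡⟨ sumℤ-cong (λ k → sumℤ-cong (λ l → ℤP.*-assoc (N j k) (M k l) (w l))) ⟩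
  sumℤ (λ k → sumℤ (λ l → N j k * (M k l * w l))) ≡⟨ sumℤ-cong (λ k → *-distribˡ-sumℤ (N j k) (λ l → M k l * w l)) ⟨
  sumℤ (λ k → N j k * (M · w) k)                  ∎

left-inverse⇒kernel-trivial : ∀ {n} (M N : Mat n) → (∀ i j → (N ⊗ M) i j ≡ δ i j) →
  ∀ {w} → (∀ k → (M · w) k ≡ 0ℤ) → ∀ j → w j ≡ 0ℤ
left-inverse⇒kernel-trivial M N NM≡I {w} Mw≡0 j = begin
  w j                                  ≡⟨ sumℤ-δˡ j w ⟨
  sumℤ (λ l → δ j l * w l)             ≡⟨ sumℤ-cong (λ l → cong (_* w l) (NM≡I j l)) ⟨
  ((N ⊗ M) · w) j                      ≡⟨ ⊗-·-assoc N M w j ⟩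
  sumℤ (λ k → N j k * (M · w) k)       ≡⟨ sumℤ-zero (λ k → trans (cong (N j k *_) (Mw≡0 k)) (ℤP.*-zeroʳ (N j k))) ⟩
  0ℤ                                   ∎

vertex∈conv : ∀ {n k} (V : Fin k → Vecℤ n) p → InConv V (toℚ ∘ V p)
vertex∈conv V p =
  (λ j → toℚ (δ p j)) , toℚ-δ-nonneg p ,
  trans (sumℚ-cong (λ j → sym (ℚP.*-identityʳ (toℚ (δ p j))))) (sumℚ-δˡ p (λ _ → 1ℚ)) ,
  λ l → sym (sumℚ-δˡ p (λ j → toℚ (V j l)))

module _ {n k} {W : Fin k → Vecℤ n} {r : Fin n} {p : Fin k} (Wr≡δ : ∀ j → W j r ≡ δ j p) where

  isolated-coordinate≡weight : ∀ {x} (x∈W : InConv W x) → x r ≡ proj₁ x∈W p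
  isolated-coordinate≡weight (λs , _ , _ , x≡) =
    trans (x≡ r) (trans (sumℚ-cong (λ j → cong (λ t → λs j ℚ.* toℚ t) (Wr≡δ j))) (sumℚ-δʳ p λs))

  isolated-coordinate-bounds : ∀ {x} → InConv W x → 0ℚ ℚ.≤ x r × x r ℚ.≤ 1ℚ
  isolated-coordinate-bounds x∈W@(λs , λs≥0 , Σλs≡1 , _) =
    subst (0ℚ ℚ.≤_) (sym xᵣ≡λₚ) (λs≥0 p) , subst₂ ℚ._≤_ (sym xᵣ≡λₚ) Σλs≡1 (term≤sumℚ λs≥0 p)
    where xᵣ≡λₚ = isolated-coordinate≡weight x∈W

  isolated-coordinate≡1⇒vertex : ∀ {x} → InConv W x → x r ≡ 1ℚ → ∀ l → x l ≡ toℚ (W p l)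
  isolated-coordinate≡1⇒vertex {x} x∈W@(λs , λs≥0 , Σλs≡1 , x≡) xᵣ≡1 l = begin
    x l                                     ≡⟨ x≡ l ⟩
    sumℚ (λ j → λs j ℚ.* toℚ (W j l))       ≡⟨ sumℚ-cong (λ j → cong (ℚ._* toℚ (W j l)) (λs≡δ j)) ⟩
    sumℚ (λ j → toℚ (δ p j) ℚ.* toℚ (W j l)) ≡⟨ sumℚ-δˡ p (λ j → toℚ (W j l)) ⟩
    toℚ (W p l)                             ∎
    where
    λs≡δ = sumℚ≡1⇒δ λs≥0 Σλs≡1 p (trans (sym (isolated-coordinate≡weight x∈W)) xᵣ≡1)

image-row-dichotomy : ∀ {n k} (M : Mat n) (u : Vecℤ n) (W : Fin k → Vecℤ n) (r : Fin n) (p : Fin k) →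
  (∀ l → u l ≡ W p l) → (∀ j → W j r ≡ δ j p) →
  ∀ w → InConv W (affine M u (toℚ ∘ w)) → (M · w) r ≡ -1ℤ ⊎ (∀ l → (M · w) l ≡ 0ℤ)
image-row-dichotomy M u W r p u≡Wp Wr≡δ w Uw∈W = Sum.map row≡-1 image≡u (0≤i≤1⇒i≡0⊎i≡1 0≤t t≤1)
  where
  t = (M · w) r + u r
  bounds = isolated-coordinate-bounds {W = W} Wr≡δ Uw∈W
  0≤t : 0ℤ ℤ.≤ t
  0≤t = toℚ-cancel-≤ (subst (0ℚ ℚ.≤_) (affine-toℚ M u w r) (proj₁ bounds))
  t≤1 : t ℤ.≤ 1ℤ
  t≤1 = toℚ-cancel-≤ (subst (ℚ._≤ 1ℚ) (affine-toℚ M u w r) (proj₂ bounds))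
  row≡-1 : t ≡ 0ℤ → (M · w) r ≡ -1ℤ
  row≡-1 t≡0 = ℤ+.inverseˡ-unique _ 1ℤ (trans (cong ((M · w) r +_) (sym uᵣ≡1)) t≡0)
    where uᵣ≡1 = trans (u≡Wp r) (trans (Wr≡δ p) (δ-refl p))
  image≡u : t ≡ 1ℤ → ∀ l → (M · w) l ≡ 0ℤ
  image≡u t≡1 l = ℤ+.identityˡ-unique _ (u l) (toℚ-injective (begin
    toℚ ((M · w) l + u l)     ≡⟨ affine-toℚ M u w l ⟨
    affine M u (toℚ ∘ w) l    ≡⟨ isolated-coordinate≡1⇒vertex {W = W} Wr≡δ Uw∈W Uwᵣ≡1 l ⟩
    toℚ (W p l)               ≡⟨ cong toℚ (u≡Wp l) ⟨
    toℚ (u l)                 ∎))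
    where Uwᵣ≡1 = trans (affine-toℚ M u w r) (cong toℚ t≡1)

det-unit⇒InGL2 : ∀ a x b y → a * y - x * b ∣ 1ℤ → InGL 2 (mat2 a x b y)
det-unit⇒InGL2 a x b y (divides q 1≡qD) = mat2 (q * y) (q * - x) (q * - b) (q * a) , right , left
  where
  ≡qD⇒≡1 : ∀ s → s ≡ q * (a * y - x * b) → s ≡ 1ℤ
  ≡qD⇒≡1 s s≡qD = trans s≡qD (sym 1≡qD)
  right : ∀ i j → (mat2 a x b y ⊗ mat2 (q * y) (q * - x) (q * - b) (q * a)) i j ≡ δ i j
  right zero zero = ≡qD⇒≡1 (a * (q * y) + (x * (q * - b) + 0ℤ)) (solve (a ∷ x ∷ b ∷ y ∷ q ∷ []))
  right zero (suc zero) = (a * (q * - x) + (x * (q * a) + 0ℤ) ≡ 0ℤ) ∋ solve (a ∷ x ∷ q ∷ [])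
  right (suc zero) zero = (b * (q * y) + (y * (q * - b) + 0ℤ) ≡ 0ℤ) ∋ solve (b ∷ y ∷ q ∷ [])
  right (suc zero) (suc zero) = ≡qD⇒≡1 (b * (q * - x) + (y * (q * a) + 0ℤ)) (solve (a ∷ x ∷ b ∷ y ∷ q ∷ []))
  left : ∀ i j → (mat2 (q * y) (q * - x) (q * - b) (q * a) ⊗ mat2 a x b y) i j ≡ δ i j
  left zero zero = ≡qD⇒≡1 (q * y * a + (q * - x * b + 0ℤ)) (solve (a ∷ x ∷ b ∷ y ∷ q ∷ []))
  left zero (suc zero) = (q * y * x + (q * - x * y + 0ℤ) ≡ 0ℤ) ∋ solve (x ∷ y ∷ q ∷ [])
  left (suc zero) zero = (q * - b * a + (q * a * b + 0ℤ) ≡ 0ℤ) ∋ solve (a ∷ b ∷ q ∷ [])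
  left (suc zero) (suc zero) = ≡qD⇒≡1 (q * - b * x + (q * a * y + 0ℤ)) (solve (a ∷ x ∷ b ∷ y ∷ q ∷ []))

det≢0⇒gcd≢0 : ∀ a b c d → a * d - b * c ≢ 0ℤ → gcd (c - a) (d - b) ≢ 0ℤ
det≢0⇒gcd≢0 a b c d det≢0 gcd≡0 = det≢0 (subst₂ (λ s t → a * t - b * s ≡ 0ℤ) (sym c≡a) (sym d≡b) ab-ba≡0)
  where
  c≡a = ℤP.i-j≡0⇒i≡j c a (gcd[i,j]≡0⇒i≡0 (c - a) (d - b) gcd≡0)
  d≡b = ℤP.i-j≡0⇒i≡j d b (gcd[i,j]≡0⇒j≡0 {c - a} gcd≡0)
  ab-ba≡0 : a * b - b * a ≡ 0ℤ
  ab-ba≡0 = trans (cong (λ s → a * b - s) (ℤP.*-comm b a)) (ℤP.+-inverseʳ (a * b))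

det≢0⇒columns≢0 : ∀ a b c d → a * d - b * c ≢ 0ℤ → ¬ (a ≡ 0ℤ × b ≡ 0ℤ) × ¬ (c ≡ 0ℤ × d ≡ 0ℤ)
det≢0⇒columns≢0 a b c d det≢0 =
  (λ (a≡0 , b≡0) → det≢0 (subst₂ (λ s t → s * d - t * c ≡ 0ℤ) (sym a≡0) (sym b≡0) refl)) ,
  (λ (c≡0 , d≡0) → det≢0 (subst₂ (λ s t → a * t - b * s ≡ 0ℤ) (sym c≡0) (sym d≡0)
                            (cong₂ _-_ (ℤP.*-zeroʳ a) (ℤP.*-zeroʳ b))))

gcd-quotients-coprime : ∀ i j {x y k} → gcd i j ≢ 0ℤ → gcd i j * x ≡ i → gcd i j * y ≡ j →
  k ∣ x → k ∣ y → k ∣ 1ℤ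
gcd-quotients-coprime i j {x} {y} {k} g≢0 gx≡i gy≡j k∣x k∣y = *-cancelʳ-∣ g kg∣1g
  where
  g = gcd i j
  instance
    _ = ℤ.≢-nonZero g≢0
  kg∣ : ∀ {w z} → g * w ≡ z → k ∣ w → k * g ∣ z
  kg∣ gw≡z k∣w = subst (k * g ∣_) (trans (ℤP.*-comm _ g) gw≡z) (*-monoˡ-∣ g k∣w)
  kg∣1g : k * g ∣ 1ℤ * g
  kg∣1g = subst (k * g ∣_) (sym (ℤP.*-identityˡ g))
                (∣ᵤ⇒∣ (gcd-greatest {i} {j} {k * g} (∣⇒∣ᵤ (kg∣ gx≡i k∣x)) (∣⇒∣ᵤ (kg∣ gy≡j k∣y))))

form-constant⇒vanishes-on-quotient : ∀ a b c d x y m₁ m₂ {g t} → g ≢ 0ℤ →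
  g * x ≡ c - a → g * y ≡ d - b → m₁ * a + m₂ * b ≡ t → m₁ * c + m₂ * d ≡ t →
  m₁ * x + m₂ * y ≡ 0ℤ
form-constant⇒vanishes-on-quotient a b c d x y m₁ m₂ {g} {t} g≢0 gx≡c-a gy≡d-b at-ab at-cd =
  ℤP.*-cancelˡ-≡ g _ 0ℤ (begin
    g * (m₁ * x + m₂ * y)                         ≡⟨ solve (g ∷ x ∷ y ∷ m₁ ∷ m₂ ∷ []) ⟩
    m₁ * (g * x) + m₂ * (g * y)                   ≡⟨ cong₂ (λ s r → m₁ * s + m₂ * r) gx≡c-a gy≡d-b ⟩
    m₁ * (c - a) + m₂ * (d - b)                   ≡⟨ solve (a ∷ b ∷ c ∷ d ∷ m₁ ∷ m₂ ∷ []) ⟩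
    (m₁ * c + m₂ * d) - (m₁ * a + m₂ * b)         ≡⟨ cong₂ _-_ at-cd at-ab ⟩
    t - t                                         ≡⟨ ℤP.+-inverseʳ t ⟩
    0ℤ                                            ≡⟨ ℤP.*-zeroʳ g ⟨
    g * 0ℤ                                        ∎)
  where
  instance
    _ = ℤ.≢-nonZero g≢0

det∣second-column : ∀ a b x y m₁ m₂ → m₁ * a + m₂ * b ≡ -1ℤ → m₁ * x + m₂ * y ≡ 0ℤ →
  a * y - x * b ∣ x × a * y - x * b ∣ y
det∣second-column a b x y m₁ m₂ ma≡-1 mx≡0 = divides m₂ x≡m₂D , divides (- m₁) y≡-m₁D
  where
  x≡m₂D : x ≡ m₂ * (a * y - x * b)
  x≡m₂D = begin
    x                                               ≡⟨ solve (a ∷ x ∷ []) ⟩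
    a * 0ℤ - x * -1ℤ                                ≡⟨ cong₂ (λ s r → a * s - x * r) mx≡0 ma≡-1 ⟨
    a * (m₁ * x + m₂ * y) - x * (m₁ * a + m₂ * b)   ≡⟨ solve (a ∷ b ∷ x ∷ y ∷ m₁ ∷ m₂ ∷ []) ⟩
    m₂ * (a * y - x * b)                            ∎
  y≡-m₁D : y ≡ - m₁ * (a * y - x * b)
  y≡-m₁D = begin
    y                                               ≡⟨ solve (b ∷ y ∷ []) ⟩
    b * 0ℤ - y * -1ℤ                                ≡⟨ cong₂ (λ s r → b * s - y * r) mx≡0 ma≡-1 ⟨
    b * (m₁ * x + m₂ * y) - y * (m₁ * a + m₂ * b)   ≡⟨ solve (a ∷ b ∷ x ∷ y ∷ m₁ ∷ m₂ ∷ []) ⟩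
    - m₁ * (a * y - x * b)                          ∎

vertsQ-isolated-coordinate : ∀ {m} a b c d (i : Fin m) (k : Fin (suc (suc (suc m)))) →
  vertsQ (suc (suc m)) a b c d k (suc (suc i)) ≡ δ k (suc (suc (suc i)))
vertsQ-isolated-coordinate a b c d i zero = refl
vertsQ-isolated-coordinate a b c d i (suc zero) = refl
vertsQ-isolated-coordinate a b c d i (suc (suc zero)) = refl
vertsQ-isolated-coordinate a b c d i (suc (suc (suc k))) = refl

·-pad2 : ∀ {m} (M : Mat (suc (suc m))) r s t → (M · pad2 s t) r ≡ M r zero * s + M r (suc zero) * t
·-pad2 M r s t = cong (M r zero * s +_) (trans (cong (M r (suc zero) * t +_) tail≡0) (ℤP.+-identityʳ _))
  where tail≡0 = sumℤ-zero (λ j → ℤP.*-zeroʳ (M r (suc (suc j))))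

lemma4p5 : (a b c d a′ b′ c′ d′ : ℤ) →
    a ℤ.* d ℤ.- b ℤ.* c ≢ ℤ.0ℤ →
    a′ ℤ.* d′ ℤ.- b′ ℤ.* c′ ≢ ℤ.0ℤ →
    (n : ℕ) → 2 ℕ.< n →
    (M : Mat n) → InGL n M → (u : Vecℤ n) →
    MapsOnto M u (vertsQ n a b c d) (vertsQ n a′ b′ c′ d′) →
    Σ (Fin n) (λ i → (2 ℕ.≤ toℕ i) × (∀ j → u j ≡ e i j)) →
    (x y : ℤ) → gcd (c ℤ.- a) (d ℤ.- b) ℤ.* x ≡ c ℤ.- a →
    gcd (c ℤ.- a) (d ℤ.- b) ℤ.* y ≡ d ℤ.- b →
    InGL 2 (mat2 a x b y)
lemma4p5 _ _ _ _ _ _ _ _ _ _ _ _ _ _ _ _ (zero , () , _) _ _ _ _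
lemma4p5 _ _ _ _ _ _ _ _ _ _ _ _ _ _ _ _ (suc zero , ℕ.s≤s () , _) _ _ _ _
lemma4p5 a b c d a′ b′ c′ d′ det≢0 _ n _ M (N , _ , NM≡I) u maps (suc (suc i) , _ , u≡eᵣ) x y gx≡c-a gy≡d-b =
  det-unit⇒InGL2 a x b y (gcd-quotients-coprime (c - a) (d - b) g≢0 gx≡c-a gy≡d-b D∣x D∣y)
  where
  r = suc (suc i)
  V = vertsQ n a b c d
  g≢0 = det≢0⇒gcd≢0 a b c d det≢0
  columns≢0 = det≢0⇒columns≢0 a b c d det≢0
  m₁ = M r zero
  m₂ = M r (suc zero)
  row≡-1 : ∀ k → ¬ (∀ l → V k l ≡ 0ℤ) → (M · V k) r ≡ -1ℤ
  row≡-1 k Vₖ≢0 =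
    [ id , (λ MVₖ≡0 → ⊥-elim (Vₖ≢0 (left-inverse⇒kernel-trivial M N NM≡I MVₖ≡0))) ]′
    (image-row-dichotomy M u (vertsQ n a′ b′ c′ d′) r (suc r) u≡eᵣ
                         (vertsQ-isolated-coordinate a′ b′ c′ d′ i) (V k) (proj₁ maps _ (vertex∈conv V k)))
  row-at-ab : m₁ * a + m₂ * b ≡ -1ℤ
  row-at-ab = trans (sym (·-pad2 M r a b))
                    (row≡-1 (suc zero) (λ ab≡0 → proj₁ columns≢0 (ab≡0 zero , ab≡0 (suc zero))))
  row-at-cd : m₁ * c + m₂ * d ≡ -1ℤ
  row-at-cd = trans (sym (·-pad2 M r c d))
                    (row≡-1 (suc (suc zero)) (λ cd≡0 → proj₂ columns≢0 (cd≡0 zero , cd≡0 (suc zero))))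
  D∣x×D∣y = det∣second-column a b x y m₁ m₂ row-at-ab
              (form-constant⇒vanishes-on-quotient a b c d x y m₁ m₂ g≢0 gx≡c-a gy≡d-b row-at-ab row-at-cd)
  D∣x = proj₁ D∣x×D∣y
  D∣y = proj₂ D∣x×D∣y
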